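{- Let $k$ be a positive integer and let $G$ be a finite simple $k$-degenerate graph with at least one edge. Then there exists an edge $xy$ in $G$ such that $\deg(x) \le k$ and at most $k$ neighbors of $y$ have degree strictly greater than $k$.
   Context: A graph $G$ is $k$-degenerate if every subgraph of $G$ has a vertex of degree at most $k$. Degrees are taken in $G$. -}

module Defs where

open import Data.Nat using (ℕ; _≤_; _>_)
open import Data.Bool using (Bool; true; false; T)
open import Data.Fin using (Fin)
open import Data.Fin.Subset using (Subset; _∈_; Nonempty)
open import Data.Vec using (count; allFin)
open import Data.Product using (∃; _×_; _,_)
open import Relation.Binary.PropositionalEquality using (_≡_)
open import Relation.Nullary using (¬_)
open import Relation.Nullary.Decidable using (_×-dec_)
open import Data.Bool.Properties using (T?)
open import Data.Nat.Properties using (_<?_)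
open import Data.Fin.Subset.Properties using (_∈?_)

record Graph (n : ℕ) : Set where
  field
    adj      : Fin n → Fin n → Bool
    symmetric  : ∀ u v → adj u v ≡ adj v u
    irreflexive : ∀ v → adj v v ≡ false

open Graph public

Adj : ∀ {n} → Graph n → Fin n → Fin n → Set
Adj G u v = T (adj G u v)

deg : ∀ {n} → Graph n → Fin n → ℕ
deg G v = count (λ u → T? (adj G v u)) (allFin _)

degIn : ∀ {n} → Graph n → Subset n → Fin n → ℕ
degIn G S v = count (λ u → T? (adj G v u) ×-dec (u ∈? S)) (allFin _)

Degenerate : ∀ {n} → ℕ → Graph n → Set
Degenerate k G = ∀ S → Nonempty S → ∃ λ v → v ∈ S × degIn G S v ≤ k

highNbrs : ∀ {n} → Graph n → ℕ → Fin n → ℕ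
highNbrs G k y = count (λ u → T? (adj G y u) ×-dec (deg G u >? k)) (allFin _)
  where
  _>?_ : ∀ a b → Relation.Nullary.Dec (a > b)
  a >? b = b <? a

-- The vertices of degree greater than k span a subgraph H. If H is empty,
-- any edge works. Otherwise degeneracy yields y ∈ H with at most k
-- neighbours in H, i.e. at most k high-degree neighbours; as deg y > k,
-- some neighbour x of y lies outside H, so deg x ≤ k.
module Submission where

open import Defs
open import Data.Nat using (ℕ; _≤_; _<_; _>_; z≤n; s≤s; s≤s⁻¹)
open import Data.Nat.Properties using (_<?_; ≤-trans; ≤-<-trans; m≤n⇒m≤1+n; ≮⇒≥)
open import Data.Bool using (T)
open import Data.Bool.Properties using (T?)
open import Data.Fin using (Fin)
open import Data.Fin.Properties using (any?)
open import Data.Fin.Subset using (Subset; _∈_)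
open import Data.Fin.Subset.Properties using (_∈?_)
open import Data.Vec using (Vec; []; _∷_; count; allFin; tabulate; lookup)
open import Data.Vec.Properties using (lookup∘tabulate; []=⇒lookup; lookup⇒[]=)
open import Data.Product using (∃; ∃₂; _×_; _,_)
open import Function using (_∘_)
open import Level using (Level)
open import Relation.Binary.PropositionalEquality using (_≡_; refl; trans; sym; subst)
open import Relation.Nullary using (yes; no; does; proof; ¬_; contradiction)
open import Relation.Nullary.Reflects using (Reflects; invert)
open import Relation.Nullary.Decidable using (dec-true)
open import Relation.Unary using (Pred; Decidable; _⊆_; Empty; Satisfiable)
open import Relation.Unary.Properties using (_∩?_)

module _ {a p : Level} {A : Set a} {P : Pred A p} (P? : Decidable P) where

  count-none : Empty P → ∀ {m} (xs : Vec A m) → count P? xs ≡ 0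
  count-none none [] = refl
  count-none none (x ∷ xs) with P? x
  ... | yes px = contradiction px (none x)
  ... | no _   = count-none none xs

module _ {a p q : Level} {A : Set a} {P : Pred A p} {Q : Pred A q}
         (P? : Decidable P) (Q? : Decidable Q) where

  count-mono : P ⊆ Q → ∀ {m} (xs : Vec A m) → count P? xs ≤ count Q? xs
  count-mono P⊆Q [] = z≤n
  count-mono P⊆Q (x ∷ xs) with P? x | Q? x
  ... | yes _  | yes _  = s≤s (count-mono P⊆Q xs)
  ... | yes px | no ¬qx = contradiction (P⊆Q px) ¬qx
  ... | no _   | yes _  = m≤n⇒m≤1+n (count-mono P⊆Q xs)
  ... | no _   | no _   = count-mono P⊆Q xs

  count-∩<count⇒∃ : ∀ {m} (xs : Vec A m) → count (P? ∩? Q?) xs < count P? xs →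
                    ∃ λ x → P x × ¬ Q x
  count-∩<count⇒∃ (x ∷ xs) lt with P? x | Q? x
  ... | yes _  | yes _  = count-∩<count⇒∃ xs (s≤s⁻¹ lt)
  ... | yes px | no ¬qx = x , px , ¬qx
  ... | no _   | _      = count-∩<count⇒∃ xs lt

module _ {n p} {P : Pred (Fin n) p} (P? : Decidable P) where

  satisfying : Subset n
  satisfying = tabulate (does ∘ P?)

  lookup-satisfying : ∀ x → lookup satisfying x ≡ does (P? x)
  lookup-satisfying = lookup∘tabulate (does ∘ P?)

  ∈-satisfying⁺ : ∀ {x} → P x → x ∈ satisfying
  ∈-satisfying⁺ {x} px = lookup⇒[]= x satisfying (trans (lookup-satisfying x) (dec-true (P? x) px))

  ∈-satisfying⁻ : ∀ {x} → x ∈ satisfying → P x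
  ∈-satisfying⁻ {x} x∈ =
    invert (subst (Reflects (P x)) (trans (sym (lookup-satisfying x)) ([]=⇒lookup x∈)) (proof (P? x)))

module _ {n} (G : Graph n) (k : ℕ) where

  High : Pred (Fin n) _
  High v = k < deg G v

  high? : Decidable High
  high? v = k <? deg G v

  Empty-High⇒highNbrs≡0 : Empty High → ∀ y → highNbrs G k y ≡ 0
  Empty-High⇒highNbrs≡0 none y =
    count-none ((T? ∘ adj G y) ∩? high?) (λ v (_ , hv) → none v hv) (allFin n)

  highNbrs≤degIn-high : ∀ y → highNbrs G k y ≤ degIn G (satisfying high?) y
  highNbrs≤degIn-high y =
    count-mono ((T? ∘ adj G y) ∩? high?) ((T? ∘ adj G y) ∩? (_∈? satisfying high?))
      (λ (ayv , hv) → ayv , ∈-satisfying⁺ high? hv) (allFin n)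

  high-vertex-with-few-high-nbrs : Degenerate k G → Satisfiable High →
                                   ∃ λ y → High y × highNbrs G k y ≤ k
  high-vertex-with-few-high-nbrs degenerate (w , hw)
    with degenerate (satisfying high?) (w , ∈-satisfying⁺ high? hw)
  ... | y , y∈H , degIn≤k = y , ∈-satisfying⁻ high? y∈H , ≤-trans (highNbrs≤degIn-high y) degIn≤k

  low-neighbour : ∀ y → highNbrs G k y < deg G y → ∃ λ x → Adj G x y × deg G x ≤ k
  low-neighbour y lt with count-∩<count⇒∃ (T? ∘ adj G y) high? (allFin n) lt
  ... | x , ayx , ¬hx = x , subst T (symmetric G y x) ayx , ≮⇒≥ ¬hx

lemma4 : (k : ℕ) → k > 0 → (n : ℕ) → (G : Graph n) → Degenerate k G →
    (∃₂ λ u v → Adj G u v) →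
    ∃₂ λ x y → Adj G x y × deg G x ≤ k × highNbrs G k y ≤ k
lemma4 k _ n G degenerate (u , v , auv) with any? (high? G k)
... | no noHigh =
  u , v , auv , ≮⇒≥ (λ hu → noHigh (u , hu)) ,
  subst (_≤ k) (sym (Empty-High⇒highNbrs≡0 G k (λ w hw → noHigh (w , hw)) v)) z≤n
... | yes someHigh with high-vertex-with-few-high-nbrs G k degenerate someHigh
... | y , hy , fewHigh with low-neighbour G k y (≤-<-trans fewHigh hy)
... | x , axy , dx = x , y , axy , dx , fewHigh
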